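{- Let $\mathcal A=(A_1,\dots,A_q)$ be a normalized tuple of finite nonempty sets of integers with $a_i^*:=\max A_i\ge1$ for every $i$. Fix $t,r\in\mathbb N$. Then there exists a threshold vector $\mathbf h_{r,t}\in\mathbb N_0^q$ such that for every $\mathbf h\succeq\mathbf h_{r,t}$ there exists a set $X_{\mathbf h}\subseteq\mathbb Z$ with $|X_{\mathbf h}|\le r+2$ and \[ ((r\mathbf h)\cdot\mathcal A)^{(t)}\subseteq X_{\mathbf h}+(\mathbf h\cdot\mathcal A)^{(t)}. \]
   Context: $\mathbb N=\{1,2,\dots\}$, $\mathbb N_0=\{0,1,2,\dots\}$. For $\mathbf h=(h_1,\dots,h_q)\in\mathbb N_0^q$, $r\mathbf h=(rh_1,\dots,rh_q)$ and $\mathbf h\preceq\mathbf h'$ means $h_i\le h_i'$ for all $i$. A tuple of finite nonempty integer sets is normalized if $\min A_i=0$ for all $i$ and $\gcd\bigl(\bigcup_i A_i\bigr)=1$. The chromatic representation function $r_{\mathcal A,\mathbf h}(n)$ is the number of tuples $(a_{1,1},\dots,a_{1,h_1};\dots;a_{q,1},\dots,a_{q,h_q})$ with $a_{i,j}\in A_i$ for all $i,j$, $a_{i,1}\le a_{i,2}\le\cdots\le a_{i,h_i}$ for each $i$, and $\sum_{i=1}^q\sum_{j=1}^{h_i}a_{i,j}=n$. For $t\in\mathbb N$, the threshold-$t$ chromatic layer is $(\mathbf h\cdot\mathcal A)^{(t)}=\{n\in\mathbb Z:r_{\mathcal A,\mathbf h}(n)\ge t\}$. For $X,Y\subseteq\mathbb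 Z$, $X+Y=\{x+y:x\in X,y\in Y\}$. -}

module Defs where

open import Data.Nat as ℕ using (ℕ; zero; suc)
open import Data.Integer as ℤ using (ℤ; +_)
open import Data.Integer.GCD using (gcd)
open import Data.Fin using (Fin; zero; suc)
open import Data.List using (List; []; _∷_; map; concatMap; foldr; length; filter; allFin; cartesianProductWith)
open import Data.List.Relation.Unary.All using (All)
open import Data.List.Relation.Unary.Unique.Propositional using (Unique)
open import Data.List.Membership.Propositional using (_∈_)
open import Data.Vec as Vec using (Vec; []; _∷_)
open import Data.Unit using (⊤)
open import Data.Product using (Σ; ∃; _×_; _,_)
open import Relation.Binary.PropositionalEquality using (_≡_)
open import Relation.Nullary using (Dec; yes; no)
open import Relation.Nullary.Decidable using (_×-dec_)

-- A finite set of integers is represented by a duplicate-free list.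
FinSetℤ : Set
FinSetℤ = List ℤ

IsSet : FinSetℤ → Set
IsSet A = Unique A

IsMin : ℤ → FinSetℤ → Set
IsMin a A = a ∈ A × All (a ℤ.≤_) A

IsMax : ℤ → FinSetℤ → Set
IsMax a A = a ∈ A × All (ℤ._≤ a) A

-- gcd of a finite list of integers (gcd of the empty list is 0)
gcdList : List ℤ → ℤ
gcdList = foldr gcd (+ 0)

-- union of the sets A_1, ..., A_q (as a list; duplicates do not affect gcd)
unionList : {q : ℕ} → (Fin q → FinSetℤ) → List ℤ
unionList {q} A = concatMap A (allFin q)

Normalized : {q : ℕ} → (Fin q → FinSetℤ) → Set
Normalized {q} A =
  ((i : Fin q) → IsSet (A i) × IsMin (+ 0) (A i)) × gcdList (unionList A) ≡ + 1

tuples : FinSetℤ → (h : ℕ) → List (Vec ℤ h)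
tuples A zero = [] ∷ []
tuples A (suc h) = cartesianProductWith _∷_ A (tuples A h)

Sorted : {h : ℕ} → Vec ℤ h → Set
Sorted [] = ⊤
Sorted (x ∷ []) = ⊤
Sorted (x ∷ y ∷ v) = x ℤ.≤ y × Sorted (y ∷ v)

sorted? : {h : ℕ} → (v : Vec ℤ h) → Dec (Sorted v)
sorted? [] = yes _
sorted? (x ∷ []) = yes _
sorted? (x ∷ y ∷ v) = (x ℤ.≤? y) ×-dec sorted? (y ∷ v)

sortedTuples : FinSetℤ → (h : ℕ) → List (Vec ℤ h)
sortedTuples A h = filter sorted? (tuples A h)

-- chromatic tuples: for each colour i, a nondecreasing h_i-tuple from A_i;
-- represented by the list of their total sums (one entry per tuple)
chromSums : (q : ℕ) → (Fin q → FinSetℤ) → (Fin q → ℕ) → List ℤ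
chromSums zero A h = + 0 ∷ []
chromSums (suc q) A h =
  cartesianProductWith ℤ._+_
    (map (Vec.foldr _ ℤ._+_ (+ 0)) (sortedTuples (A zero) (h zero)))
    (chromSums q (λ i → A (suc i)) (λ i → h (suc i)))

rep : {q : ℕ} → (Fin q → FinSetℤ) → (Fin q → ℕ) → ℤ → ℕ
rep {q} A h n = length (filter (λ s → s ℤ.≟ n) (chromSums q A h))

InLayer : {q : ℕ} → ℕ → (Fin q → FinSetℤ) → (Fin q → ℕ) → ℤ → Set
InLayer t A h n = t ℕ.≤ rep A h n

scaleVec : {q : ℕ} → ℕ → (Fin q → ℕ) → (Fin q → ℕ)
scaleVec r h i = r ℕ.* h i

_⪯_ : {q : ℕ} → (Fin q → ℕ) → (Fin q → ℕ) → Set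
h ⪯ h' = ∀ i → h i ℕ.≤ h' i

_⊆_⊕_ : (ℤ → Set) → List ℤ → (ℤ → Set) → Set
Y ⊆ X ⊕ Z = ∀ n → Y n → Σ ℤ λ x → Σ ℤ λ m → x ∈ X × Z m × n ≡ x ℤ.+ m

{-# OPTIONS --safe #-}
module Submission where

-- Let M_i = max A_i and H(h) = h_1 M_1 + ... + h_q M_q.  Every element of a layer of r h lies in
-- [0, r H(h)].  Conversely, for h beyond a threshold the layer of h contains a whole window
-- [base, base + W(h)] whose length falls short of H(h) only by a constant: a target m is split
-- greedily into a bulk of maxima plus a bounded remainder ρ + Q M_1 with ρ < M_1; the remainder is
-- realised by ρ copies of a pair of families whose weights differ by 1 (Bézout, as the gcd is 1)
-- padded with copies of M_1.  Trading blocks of M_1 copies of a second element b against b copies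
-- of M_1 yields t representations, told apart by how often M_1 occurs in the first colour.  Then
-- r + 1 translates of the window cover [0, r H(h)].  The one exception is q = 1, A_1 = {0, 1}, where
-- sorted 0/1-tuples are determined by their sum, so that for t ≥ 2 every layer is empty.

open import Defs

open import Data.Bool using (true; false)
open import Data.Empty using (⊥-elim)
open import Data.Fin as Fin using (Fin; zero; suc; toℕ)
open import Data.Fin.Properties using (injective⇒≤; toℕ-injective; toℕ≤pred[n]; toℕ-fromℕ<)
open import Data.Integer as ℤ using (ℤ; +_)
import Data.Integer.Properties as ℤ
import Data.Integer.Tactic.RingSolver as ℤ-Solver
open import Data.List as List using (List; []; _∷_; _++_; length; map; filter; cartesianProductWith)
open import Data.List.Membership.Propositional using (_∈_; find)
open import Data.List.Membership.Propositional.Properties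
  using ( ∈-filter⁺; ∈-filter⁻; ∈-cartesianProductWith⁺; ∈-cartesianProductWith⁻; ∈-concatMap⁻
        ; ∈-map⁺; ∈-allFin)
open import Data.List.Properties
  using ( map-++; map-∘; length-++; length-replicate; length-map; length-tabulate
        ; filter-++; filter-accept; filter-reject)
open import Data.List.Relation.Unary.All as All using (All; []; _∷_)
import Data.List.Relation.Unary.All.Properties as All
open import Data.List.Relation.Unary.All.Properties using (¬All⇒Any¬)
open import Data.List.Relation.Unary.AllPairs using ([]; _∷_)
open import Data.List.Relation.Unary.Any using (here; there; index; satisfied)
open import Data.List.Relation.Unary.Any.Properties using (lookup-index)
open import Data.List.Relation.Unary.Unique.Propositional using (Unique)
import Data.List.Relation.Unary.Unique.Propositional.Properties as Unique
open import Data.Nat as ℕ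
  using (ℕ; zero; suc; z≤n; s≤s; _≤_; _<_; _+_; _*_; _∸_; pred; NonZero; ≢-nonZero; ≢-nonZero⁻¹; >-nonZero)
open import Data.Nat.DivMod using (_/_; _%_; m≡m%n+[m/n]*n; m%n<n; m/n*n≤m; m/n≤m; m<n*o⇒m/o<n)
open import Data.Nat.Divisibility using (_∣_; _∣0; ∣-refl; ∣1⇒≡1)
open import Data.Nat.GCD using (gcd; gcd-GCD; gcd-greatest; module Bézout)
open import Data.Nat.ListAction using (sum)
open import Data.Nat.ListAction.Properties using (sum-++)
open import Data.Nat.Properties
import Data.Nat.Tactic.RingSolver as ℕ-Solver
open import Data.Product using (Σ; ∃; _×_; _,_; proj₁; proj₂)
open import Data.Sum using (_⊎_; inj₁; inj₂)
open import Data.Unit using (⊤; tt)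
open import Data.Vec as Vec using (Vec; []; _∷_)
import Data.Vec.Functional as Vector
open import Data.Vec.Properties using (∷-injective)
import Data.Vec.Relation.Unary.All as Vecᴬ
open import Function using (_∘_; Injective)
open import Relation.Binary.PropositionalEquality
open import Relation.Nullary using (Dec; yes; no)
open import Relation.Nullary.Decidable using (_⊎-dec_)
open import Relation.Nullary.Negation using (contradiction)

open import Algebra.Properties.Semiring.Sum +-*-semiring
  using (sum-syntax; sum-cong-≗; ∑-distrib-+; sum-replicate-zero; *-distribˡ-sum)

-- Chromatic tuples and the representation function

vsum : ∀ {n} → Vec ℤ n → ℤ
vsum = Vec.foldr _ ℤ._+_ (+ 0)

ChromTuple : (q : ℕ) → (Fin q → ℕ) → Set
ChromTuple zero    h = ⊤
ChromTuple (suc q) h = Vec ℤ (h zero) × ChromTuple q (h ∘ suc)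

chromTuples : (q : ℕ) → (Fin q → FinSetℤ) → (h : Fin q → ℕ) → List (ChromTuple q h)
chromTuples zero    A h = tt ∷ []
chromTuples (suc q) A h =
  cartesianProductWith _,_ (sortedTuples (A zero) (h zero)) (chromTuples q (A ∘ suc) (h ∘ suc))

total : ∀ {q h} → ChromTuple q h → ℤ
total {zero}  _       = + 0
total {suc q} (v , w) = vsum v ℤ.+ total w

cartesianProductWith-map : ∀ {A B C D E : Set} (f : C → D → E) (g : A → C) (k : B → D) xs ys →
  cartesianProductWith f (map g xs) (map k ys) ≡
  map (λ (x , y) → f (g x) (k y)) (cartesianProductWith _,_ xs ys)
cartesianProductWith-map f g k []       ys = refl
cartesianProductWith-map f g k (x ∷ xs) ys = begin
  map (f (g x)) (map k ys) ++ cartesianProductWith f (map g xs) (map k ys)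
    ≡⟨ cong₂ _++_ (sym (map-∘ ys)) (cartesianProductWith-map f g k xs ys) ⟩
  map (λ y → f (g x) (k y)) ys ++ map _ (cartesianProductWith _,_ xs ys)
    ≡⟨ cong (_++ _) (map-∘ ys) ⟩
  map _ (map (x ,_) ys) ++ map _ (cartesianProductWith _,_ xs ys)
    ≡⟨ map-++ _ (map (x ,_) ys) _ ⟨
  map _ (cartesianProductWith _,_ (x ∷ xs) ys) ∎
  where open ≡-Reasoning

chromSums≡map-total : ∀ q A h → chromSums q A h ≡ map total (chromTuples q A h)
chromSums≡map-total zero    A h = refl
chromSums≡map-total (suc q) A h = begin
  cartesianProductWith ℤ._+_ (map vsum S) (chromSums q (A ∘ suc) (h ∘ suc))
    ≡⟨ cong (cartesianProductWith ℤ._+_ (map vsum S)) (chromSums≡map-total q (A ∘ suc) (h ∘ suc)) ⟩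
  cartesianProductWith ℤ._+_ (map vsum S) (map total (chromTuples q (A ∘ suc) (h ∘ suc)))
    ≡⟨ cartesianProductWith-map ℤ._+_ vsum total S _ ⟩
  map (total {h = h}) (chromTuples (suc q) A h) ∎
  where
  open ≡-Reasoning
  S = sortedTuples (A zero) (h zero)

length-filter-map : ∀ {X : Set} (f : X → ℤ) n xs →
  length (filter (ℤ._≟ n) (map f xs)) ≡ length (filter (λ x → f x ℤ.≟ n) xs)
length-filter-map f n []       = refl
length-filter-map f n (x ∷ xs) with f x ℤ.≟ n
... | yes _ = cong suc (length-filter-map f n xs)
... | no  _ = length-filter-map f n xs

rep≡length-filter : ∀ {q} (A : Fin q → FinSetℤ) h n →
  rep A h n ≡ length (filter (λ c → total c ℤ.≟ n) (chromTuples q A h))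
rep≡length-filter {q} A h n =
  trans (cong (length ∘ filter (ℤ._≟ n)) (chromSums≡map-total q A h))
        (length-filter-map total n (chromTuples q A h))

injection⇒≤length : ∀ {X : Set} {t} {xs : List X} (f : Fin t → X) →
  Injective _≡_ _≡_ f → (∀ j → f j ∈ xs) → t ≤ length xs
injection⇒≤length {xs = xs} f f-inj f∈ = injective⇒≤ {f = index ∘ f∈} λ {i} {j} eq →
  f-inj (trans (lookup-index (f∈ i)) (trans (cong (List.lookup xs) eq) (sym (lookup-index (f∈ j)))))

injection⇒≤rep : ∀ {q t} (A : Fin q → FinSetℤ) h n (f : Fin t → ChromTuple q h) → Injective _≡_ _≡_ f →
  (∀ j → f j ∈ chromTuples q A h × total (f j) ≡ n) → t ≤ rep A h n
injection⇒≤rep A h n f f-inj f∈ = subst (_ ≤_) (sym (rep≡length-filter A h n))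
  (injection⇒≤length f f-inj λ j → ∈-filter⁺ (λ c → total c ℤ.≟ n) (proj₁ (f∈ j)) (proj₂ (f∈ j)))

1≤rep⇒represented : ∀ {q} (A : Fin q → FinSetℤ) h n → 1 ≤ rep A h n →
  ∃ λ c → c ∈ chromTuples q A h × total c ≡ n
1≤rep⇒represented A h n 1≤rep with filter (λ c → total c ℤ.≟ n) (chromTuples _ A h) in eq
  | subst (1 ≤_) (rep≡length-filter A h n) 1≤rep
... | []    | ()
... | c ∷ _ | _ = c , ∈-filter⁻ (λ c → total c ℤ.≟ n) (subst (c ∈_) (sym eq) (here refl))

all-equal⇒length≤1 : ∀ {X : Set} {xs : List X} → Unique xs → (∀ {x y} → x ∈ xs → y ∈ xs → x ≡ y) →
  length xs ≤ 1
all-equal⇒length≤1 {xs = []}         _                 _  = z≤n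
all-equal⇒length≤1 {xs = _ ∷ []}     _                 _  = s≤s z≤n
all-equal⇒length≤1 {xs = _ ∷ _ ∷ _} ((x≢y ∷ _) ∷ _) same = ⊥-elim (x≢y (same (here refl) (there (here refl))))

total-injective⇒rep≤1 : ∀ {q} (A : Fin q → FinSetℤ) h n → Unique (chromTuples q A h) →
  (∀ {c d} → c ∈ chromTuples q A h → d ∈ chromTuples q A h → total c ≡ total d → c ≡ d) →
  rep A h n ≤ 1
total-injective⇒rep≤1 A h n unique total-inj = subst (_≤ 1) (sym (rep≡length-filter A h n))
  (all-equal⇒length≤1 (Unique.filter⁺ P? unique) λ c∈ d∈ →
    let c∈′ , c≡n = ∈-filter⁻ P? c∈ ; d∈′ , d≡n = ∈-filter⁻ P? d∈ in
    total-inj c∈′ d∈′ (trans c≡n (sym d≡n)))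
  where P? = λ c → total c ℤ.≟ n

∈-tuples⁺ : ∀ {A n} {v : Vec ℤ n} → Vecᴬ.All (_∈ A) v → v ∈ tuples A n
∈-tuples⁺ Vecᴬ.[]         = here refl
∈-tuples⁺ (x∈A Vecᴬ.∷ v∈) = ∈-cartesianProductWith⁺ _∷_ x∈A (∈-tuples⁺ v∈)

∈-tuples⁻ : ∀ {A n} {v : Vec ℤ n} → v ∈ tuples A n → Vecᴬ.All (_∈ A) v
∈-tuples⁻ {n = zero}  {[]}    _  = Vecᴬ.[]
∈-tuples⁻ {A} {suc n} {x ∷ v} v∈ with ∈-cartesianProductWith⁻ _∷_ A (tuples A n) v∈
... | _ , _ , x∈A , v∈′ , refl = x∈A Vecᴬ.∷ ∈-tuples⁻ v∈′

Bounded : FinSetℤ → ℕ → Set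
Bounded A M = ∀ {x} → x ∈ A → + 0 ℤ.≤ x × x ℤ.≤ + M

infix 7 _∙_

_∙_ : ∀ {q} → (Fin q → ℕ) → (Fin q → ℕ) → ℕ
_∙_ {q} s M = ∑[ i < q ] (s i * M i)

vsum-bounds : ∀ {A M n} {v : Vec ℤ n} → Bounded A M → Vecᴬ.All (_∈ A) v →
  + 0 ℤ.≤ vsum v × vsum v ℤ.≤ + (n * M)
vsum-bounds bounded Vecᴬ.[] = ℤ.+≤+ z≤n , ℤ.+≤+ z≤n
vsum-bounds {M = M} {suc n} bounded (x∈A Vecᴬ.∷ v∈) =
  let 0≤x , x≤M = bounded x∈A ; 0≤v , v≤nM = vsum-bounds bounded v∈ in
  ℤ.+-mono-≤ 0≤x 0≤v , ℤ.≤-trans (ℤ.+-mono-≤ x≤M v≤nM) (ℤ.≤-reflexive (sym (ℤ.pos-+ M (n * M))))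

total-bounds : ∀ {q A h} (M : Fin q → ℕ) → (∀ i → Bounded (A i) (M i)) → ∀ {c} →
  c ∈ chromTuples q A h → + 0 ℤ.≤ total c × total c ℤ.≤ + (h ∙ M)
total-bounds {zero} M bounded _ = ℤ.+≤+ z≤n , ℤ.+≤+ z≤n
total-bounds {suc q} {A} {h} M bounded {v , w} c∈
  with ∈-cartesianProductWith⁻ _,_ (sortedTuples (A zero) (h zero)) (chromTuples q (A ∘ suc) (h ∘ suc)) c∈
... | _ , _ , v∈ , w∈ , refl =
  let 0≤v , v≤ = vsum-bounds (bounded zero) (∈-tuples⁻ (proj₁ (∈-filter⁻ sorted? v∈)))
      0≤w , w≤ = total-bounds (M ∘ suc) (bounded ∘ suc) w∈ in
  ℤ.+-mono-≤ 0≤v 0≤w , ℤ.≤-trans (ℤ.+-mono-≤ v≤ w≤) (ℤ.≤-reflexive (sym (ℤ.pos-+ (h zero * M zero) _)))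

≤-∑ : ∀ {q} (f : Fin q → ℕ) i → f i ≤ ∑[ j < q ] f j
≤-∑ f zero    = m≤m+n (f zero) _
≤-∑ f (suc i) = ≤-trans (≤-∑ (f ∘ suc) i) (m≤n+m _ (f zero))

1≤rep⇒bounded : ∀ {q} {A : Fin q → FinSetℤ} (M : Fin q → ℕ) → (∀ i → Bounded (A i) (M i)) → ∀ h n →
  1 ≤ rep A h n → ∃ λ k → n ≡ + k × k ≤ h ∙ M
1≤rep⇒bounded M bounded h n 1≤rep with 1≤rep⇒represented _ h n 1≤rep
... | c , c∈ , refl = let 0≤c , c≤ = total-bounds M bounded c∈ in
  ℤ.∣ total c ∣ , sym (ℤ.0≤i⇒+∣i∣≡i 0≤c) , ℤ.drop‿+≤+ (subst (ℤ._≤ _) (sym (ℤ.0≤i⇒+∣i∣≡i 0≤c)) c≤)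

scaleVec-∙ : ∀ {q} r (h M : Fin q → ℕ) → scaleVec r h ∙ M ≡ r * (h ∙ M)
scaleVec-∙ r h M = trans (sum-cong-≗ (λ i → *-assoc r (h i) (M i))) (sym (*-distribˡ-sum r (λ i → h i * M i)))

∙-reserve : ∀ {q} Λ (h M : Fin q → ℕ) → (∀ i → Λ ≤ h i) →
  h ∙ M ≡ (λ i → h i ∸ Λ) ∙ M + Λ * ∑[ i < q ] M i
∙-reserve Λ h M Λ≤h = begin
  h ∙ M                                       ≡⟨ sum-cong-≗ split ⟩
  ∑[ i < _ ] ((h i ∸ Λ) * M i + Λ * M i)     ≡⟨ ∑-distrib-+ (λ i → (h i ∸ Λ) * M i) (λ i → Λ * M i) ⟩
  (λ i → h i ∸ Λ) ∙ M + ∑[ i < _ ] (Λ * M i)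
    ≡⟨ cong (λ w → (λ i → h i ∸ Λ) ∙ M + w) (*-distribˡ-sum Λ M) ⟨
  (λ i → h i ∸ Λ) ∙ M + Λ * ∑[ i < _ ] M i   ∎
  where
  open ≡-Reasoning
  split : ∀ i → h i * M i ≡ (h i ∸ Λ) * M i + Λ * M i
  split i = trans (cong (_* M i) (sym (m∸n+n≡m (Λ≤h i)))) (*-distribʳ-+ (M i) (h i ∸ Λ) Λ)

-- Families of values, and the chromatic tuples they fill

Family : ℕ → Set
Family q = Fin q → List ℕ

weight : ∀ {q} → Family q → ℕ
weight {q} F = ∑[ i < q ] sum (F i)

ValidFamily : ∀ {q} → (Fin q → FinSetℤ) → Family q → Set
ValidFamily A F = ∀ i → All (λ a → + a ∈ A i) (F i)

Fits : ∀ {q} → Family q → (Fin q → ℕ) → Set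
Fits F h = ∀ i → length (F i) ≤ h i

insert : ℤ → ∀ {n} → Vec ℤ n → Vec ℤ (suc n)
insert a []      = a ∷ []
insert a (x ∷ v) with a ℤ.≤? x
... | yes _ = a ∷ x ∷ v
... | no  _ = x ∷ insert a v

insert-sorted-∷ : ∀ {x a n} (v : Vec ℤ n) → x ℤ.≤ a → Sorted (x ∷ v) → Sorted (x ∷ insert a v)
insert-sorted-∷     []      x≤a _             = x≤a , tt
insert-sorted-∷ {a = a} (y ∷ v) x≤a (x≤y , y∷v↗) with a ℤ.≤? y
... | yes a≤y = x≤a , a≤y , y∷v↗
... | no  a≰y = x≤y , insert-sorted-∷ v (ℤ.<⇒≤ (ℤ.≰⇒> a≰y)) y∷v↗

insert-sorted : ∀ a {n} (v : Vec ℤ n) → Sorted v → Sorted (insert a v)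
insert-sorted a []      _  = tt
insert-sorted a (y ∷ v) v↗ with a ℤ.≤? y
... | yes a≤y = a≤y , v↗
... | no  a≰y = insert-sorted-∷ v (ℤ.<⇒≤ (ℤ.≰⇒> a≰y)) v↗

insert-∈ : ∀ {A a n} {v : Vec ℤ n} → a ∈ A → Vecᴬ.All (_∈ A) v → Vecᴬ.All (_∈ A) (insert a v)
insert-∈ a∈A Vecᴬ.[] = a∈A Vecᴬ.∷ Vecᴬ.[]
insert-∈ {a = a} {v = x ∷ v} a∈A (x∈A Vecᴬ.∷ v∈) with a ℤ.≤? x
... | yes _ = a∈A Vecᴬ.∷ x∈A Vecᴬ.∷ v∈
... | no  _ = x∈A Vecᴬ.∷ insert-∈ a∈A v∈

vsum-insert : ∀ a {n} (v : Vec ℤ n) → vsum (insert a v) ≡ a ℤ.+ vsum v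
vsum-insert a []      = refl
vsum-insert a (x ∷ v) with a ℤ.≤? x
... | yes _ = refl
... | no  _ = trans (cong (λ s → x ℤ.+ s) (vsum-insert a v)) (swap x a (vsum v))
  where
  swap : ∀ x a s → x ℤ.+ (a ℤ.+ s) ≡ a ℤ.+ (x ℤ.+ s)
  swap = ℤ-Solver.solve-∀

countᵥ : ℤ → ∀ {n} → Vec ℤ n → ℕ
countᵥ z = Vec.count (ℤ._≟ z)

count-insert : ∀ z a {n} (v : Vec ℤ n) → countᵥ z (insert a v) ≡ countᵥ z (a ∷ v)
count-insert z a []      = refl
count-insert z a (x ∷ v) with a ℤ.≤? x
... | yes _ = refl
... | no  _ rewrite count-insert z a v with a ℤ.≟ z | x ℤ.≟ z
...   | yes _ | yes _ = refl
...   | yes _ | no  _ = refl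
...   | no  _ | yes _ = refl
...   | no  _ | no  _ = refl

countₗ : ℕ → List ℕ → ℕ
countₗ d = length ∘ filter (ℕ._≟ d)

-- When as is longer than n, only its first n entries are used.
padSort : List ℕ → (n : ℕ) → Vec ℤ n
padSort []       n       = Vec.replicate n (+ 0)
padSort (a ∷ as) zero    = []
padSort (a ∷ as) (suc n) = insert (+ a) (padSort as n)

padSort-sorted : ∀ as n → Sorted (padSort as n)
padSort-sorted []       zero          = tt
padSort-sorted []       (suc zero)    = tt
padSort-sorted []       (suc (suc n)) = ℤ.≤-refl , padSort-sorted [] (suc n)
padSort-sorted (a ∷ as) zero          = tt
padSort-sorted (a ∷ as) (suc n)       = insert-sorted (+ a) (padSort as n) (padSort-sorted as n)

padSort-∈ : ∀ {A} as n → + 0 ∈ A → All (λ a → + a ∈ A) as → Vecᴬ.All (_∈ A) (padSort as n)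
padSort-∈ []       zero    0∈A _            = Vecᴬ.[]
padSort-∈ []       (suc n) 0∈A _            = 0∈A Vecᴬ.∷ padSort-∈ [] n 0∈A []
padSort-∈ (a ∷ as) zero    0∈A _            = Vecᴬ.[]
padSort-∈ (a ∷ as) (suc n) 0∈A (a∈A ∷ as∈A) = insert-∈ a∈A (padSort-∈ as n 0∈A as∈A)

vsum-padSort : ∀ as n → length as ≤ n → vsum (padSort as n) ≡ + sum as
vsum-padSort []       zero    _             = refl
vsum-padSort []       (suc n) _             = trans (ℤ.+-identityˡ _) (vsum-padSort [] n z≤n)
vsum-padSort (a ∷ as) (suc n) (s≤s |as|≤n) = begin
  vsum (insert (+ a) (padSort as n)) ≡⟨ vsum-insert (+ a) (padSort as n) ⟩
  + a ℤ.+ vsum (padSort as n)        ≡⟨ cong (λ s → + a ℤ.+ s) (vsum-padSort as n |as|≤n) ⟩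
  + a ℤ.+ + sum as                   ≡⟨ ℤ.pos-+ a (sum as) ⟨
  + (a + sum as)                     ∎
  where open ≡-Reasoning

count-padSort : ∀ {d} → d ≢ 0 → ∀ as n → length as ≤ n → countᵥ (+ d) (padSort as n) ≡ countₗ d as
count-padSort {zero}  d≢0 _        _       _ = ⊥-elim (d≢0 refl)
count-padSort {suc d} _   []       zero    _ = refl
count-padSort {suc d} _   []       (suc n) _ = count-padSort (λ ()) [] n z≤n
count-padSort {suc d} _   (a ∷ as) (suc n) (s≤s |as|≤n)
  rewrite count-insert (+ suc d) (+ a) (padSort as n) with a ℕ.≡ᵇ suc d
... | true  = cong suc (count-padSort (λ ()) as n |as|≤n)
... | false = count-padSort (λ ()) as n |as|≤n

build : ∀ {q h} → Family q → ChromTuple q h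
build {zero}      F = tt
build {suc q} {h} F = padSort (F zero) (h zero) , build (F ∘ suc)

build-∈ : ∀ {q A h} {F : Family q} → (∀ i → + 0 ∈ A i) → ValidFamily A F → Fits F h →
  build F ∈ chromTuples q A h
build-∈ {zero}              0∈A F-valid F-fits = here refl
build-∈ {suc q} {A} {h} {F} 0∈A F-valid F-fits = ∈-cartesianProductWith⁺ _,_
  (∈-filter⁺ sorted? (∈-tuples⁺ (padSort-∈ (F zero) (h zero) (0∈A zero) (F-valid zero)))
                     (padSort-sorted (F zero) (h zero)))
  (build-∈ (0∈A ∘ suc) (F-valid ∘ suc) (F-fits ∘ suc))

total-build : ∀ {q h} (F : Family q) → Fits F h → total (build {h = h} F) ≡ + weight F
total-build {zero}      F F-fits = refl
total-build {suc q} {h} F F-fits = begin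
  vsum (padSort (F zero) (h zero)) ℤ.+ total (build {h = h ∘ suc} (F ∘ suc))
    ≡⟨ cong₂ ℤ._+_ (vsum-padSort (F zero) (h zero) (F-fits zero)) (total-build (F ∘ suc) (F-fits ∘ suc)) ⟩
  + sum (F zero) ℤ.+ + weight (F ∘ suc)
    ≡⟨ ℤ.pos-+ (sum (F zero)) (weight (F ∘ suc)) ⟨
  + weight F ∎
  where open ≡-Reasoning

families⇒≤rep : ∀ {q t} {A : Fin q → FinSetℤ} {h} {n} (F : Fin t → Family q) →
  (∀ i → + 0 ∈ A i) → (∀ j → ValidFamily A (F j)) → (∀ j → Fits (F j) h) → (∀ j → weight (F j) ≡ n) →
  Injective _≡_ _≡_ (λ j → build {h = h} (F j)) → t ≤ rep A h (+ n)
families⇒≤rep {A = A} {h} {n} F 0∈A F-valid F-fits F-weight build-inj =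
  injection⇒≤rep A h (+ n) (λ j → build {h = h} (F j)) build-inj λ j →
    build-∈ 0∈A (F-valid j) (F-fits j) , trans (total-build (F j) (F-fits j)) (cong +_ (F-weight j))

count-build : ∀ {q d} {h : Fin (suc q) → ℕ} → d ≢ 0 → ∀ (F G : Family (suc q)) → Fits F h → Fits G h →
  build {h = h} F ≡ build {h = h} G → countₗ d (F zero) ≡ countₗ d (G zero)
count-build {q} {d} {h} d≢0 F G F-fits G-fits F≡G = begin
  countₗ d (F zero)                             ≡⟨ count-padSort d≢0 (F zero) (h zero) (F-fits zero) ⟨
  countᵥ (+ d) (proj₁ (build {h = h} F))        ≡⟨ cong (countᵥ (+ d) ∘ proj₁) F≡G ⟩
  countᵥ (+ d) (proj₁ (build {h = h} G))        ≡⟨ count-padSort d≢0 (G zero) (h zero) (G-fits zero) ⟩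
  countₗ d (G zero)                             ∎
  where open ≡-Reasoning

∅ᶠ : ∀ {q} → Family q
∅ᶠ _ = []

infixr 5 _∪ᶠ_
infixr 6 _·ᶠ_

_∪ᶠ_ : ∀ {q} → Family q → Family q → Family q
(F ∪ᶠ G) i = F i ++ G i

_·ᶠ_ : ∀ {q} → ℕ → Family q → Family q
zero  ·ᶠ F = ∅ᶠ
suc k ·ᶠ F = F ∪ᶠ k ·ᶠ F

atom : ∀ {q} → Fin q → ℕ → Family q
atom zero    a zero    = a ∷ []
atom zero    a (suc j) = []
atom (suc i) a zero    = []
atom (suc i) a (suc j) = atom i a j

replicateᶠ : ∀ {q} → (Fin q → ℕ) → (Fin q → ℕ) → Family q
replicateᶠ s M i = List.replicate (s i) (M i)

weight-∅ : ∀ {q} → weight {q} ∅ᶠ ≡ 0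
weight-∅ {q} = sum-replicate-zero q

weight-∪ : ∀ {q} (F G : Family q) → weight (F ∪ᶠ G) ≡ weight F + weight G
weight-∪ F G = trans (sum-cong-≗ (λ i → sum-++ (F i) (G i))) (∑-distrib-+ (sum ∘ F) (sum ∘ G))

weight-· : ∀ {q} k (F : Family q) → weight (k ·ᶠ F) ≡ k * weight F
weight-· {q} zero F = weight-∅ {q}
weight-· (suc k) F = trans (weight-∪ F (k ·ᶠ F)) (cong (λ w → weight F + w) (weight-· k F))

weight-atom : ∀ {q} (i : Fin q) a → weight (atom i a) ≡ a
weight-atom {suc q} zero    a = trans (cong₂ _+_ (+-identityʳ a) (weight-∅ {q})) (+-identityʳ a)
weight-atom {suc q} (suc i) a = weight-atom i a

sum-replicate : ∀ n m → sum (List.replicate n m) ≡ n * m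
sum-replicate zero    m = refl
sum-replicate (suc n) m = cong (λ w → m + w) (sum-replicate n m)

weight-·atom : ∀ {q} k (i : Fin q) a → weight (k ·ᶠ atom i a) ≡ k * a
weight-·atom k i a = trans (weight-· k (atom i a)) (cong (k *_) (weight-atom i a))

weight-replicateᶠ : ∀ {q} (s M : Fin q → ℕ) → weight (replicateᶠ s M) ≡ s ∙ M
weight-replicateᶠ s M = sum-cong-≗ (λ i → sum-replicate (s i) (M i))

atom-valid : ∀ {q} {A : Fin q → FinSetℤ} {i a} → + a ∈ A i → ValidFamily A (atom i a)
atom-valid {i = zero}  a∈A zero    = a∈A ∷ []
atom-valid {i = zero}  a∈A (suc j) = []
atom-valid {i = suc i} a∈A zero    = []
atom-valid {A = A} {i = suc i} a∈A (suc j) = atom-valid {A = A ∘ suc} {i = i} a∈A j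

module _ {q} {A : Fin q → FinSetℤ} where

  ∅ᶠ-valid : ValidFamily A ∅ᶠ
  ∅ᶠ-valid _ = []

  ∪ᶠ-valid : ∀ {F G} → ValidFamily A F → ValidFamily A G → ValidFamily A (F ∪ᶠ G)
  ∪ᶠ-valid F-valid G-valid i = All.++⁺ (F-valid i) (G-valid i)

  ·ᶠ-valid : ∀ k {F} → ValidFamily A F → ValidFamily A (k ·ᶠ F)
  ·ᶠ-valid zero    F-valid = ∅ᶠ-valid
  ·ᶠ-valid (suc k) F-valid = ∪ᶠ-valid F-valid (·ᶠ-valid k F-valid)

  replicateᶠ-valid : ∀ s {M} → (∀ i → + M i ∈ A i) → ValidFamily A (replicateᶠ s M)
  replicateᶠ-valid s M∈A i = All.replicate⁺ (s i) (M∈A i)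

countₗ-++ : ∀ d xs ys → countₗ d (xs ++ ys) ≡ countₗ d xs + countₗ d ys
countₗ-++ d xs ys = trans (cong length (filter-++ (ℕ._≟ d) xs ys)) (length-++ (filter (ℕ._≟ d) xs))

countₗ-atom-zero : ∀ {q} d k → countₗ d ((k ·ᶠ atom {suc q} zero d) zero) ≡ k
countₗ-atom-zero d zero    = refl
countₗ-atom-zero d (suc k) =
  trans (cong length (filter-accept (ℕ._≟ d) refl)) (cong suc (countₗ-atom-zero d k))

countₗ-atom-other : ∀ {q d} (c : Fin (suc q)) {b} → (c ≡ zero → b ≢ d) → ∀ k →
  countₗ d ((k ·ᶠ atom c b) zero) ≡ 0
countₗ-atom-other c       not-d zero    = refl
countₗ-atom-other zero    not-d (suc k) =
  trans (cong length (filter-reject (ℕ._≟ _) (not-d refl))) (countₗ-atom-other zero not-d k)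
countₗ-atom-other (suc c) not-d (suc k) = countₗ-atom-other (suc c) not-d k

atom-fits : ∀ {q} (j : Fin q) a → Fits (atom j a) (λ _ → 1)
atom-fits zero    a zero    = ≤-refl
atom-fits zero    a (suc i) = z≤n
atom-fits (suc j) a zero    = z≤n
atom-fits (suc j) a (suc i) = atom-fits j a i

module _ {q : ℕ} where

  ∪ᶠ-fits : ∀ {F G : Family q} {f g} → Fits F f → Fits G g → Fits (F ∪ᶠ G) (λ i → f i + g i)
  ∪ᶠ-fits {F} {G} F-fits G-fits i =
    subst (_≤ _) (sym (length-++ (F i))) (+-mono-≤ (F-fits i) (G-fits i))

  ·ᶠ-fits : ∀ k {F : Family q} {f} → Fits F f → Fits (k ·ᶠ F) (λ i → k * f i)
  ·ᶠ-fits zero    F-fits i = z≤n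
  ·ᶠ-fits (suc k) {F} F-fits = ∪ᶠ-fits {F} {k ·ᶠ F} F-fits (·ᶠ-fits k F-fits)

  replicateᶠ-fits : ∀ (s M : Fin q → ℕ) → Fits (replicateᶠ s M) s
  replicateᶠ-fits s M i = ≤-reflexive (length-replicate (s i))

  fits-weaken : ∀ {F : Family q} {f g} → Fits F f → (∀ i → f i ≤ g i) → Fits F g
  fits-weaken F-fits f≤g i = ≤-trans (F-fits i) (f≤g i)

-- Pairs of families whose weights differ by a gcd

record WeightGap {q} (A : Fin q → FinSetℤ) (g : ℕ) : Set where
  field
    lower upper : Family q
    lower-valid : ValidFamily A lower
    upper-valid : ValidFamily A upper
    weight-gap  : weight upper ≡ weight lower + g

module _ {q} {A : Fin q → FinSetℤ} where
  open WeightGap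

  gap-zero : WeightGap A 0
  gap-zero = record
    { lower = ∅ᶠ ; upper = ∅ᶠ ; lower-valid = ∅ᶠ-valid ; upper-valid = ∅ᶠ-valid
    ; weight-gap = sym (+-identityʳ (weight {q} ∅ᶠ)) }

  gap-element : ∀ {i a} → + a ∈ A i → WeightGap A a
  gap-element {i} {a} a∈A = record
    { lower = ∅ᶠ ; upper = atom i a ; lower-valid = ∅ᶠ-valid ; upper-valid = atom-valid a∈A
    ; weight-gap = trans (weight-atom i a) (cong (_+ a) (sym (weight-∅ {q}))) }

  -- x copies of a gap m minus y copies of a gap n leave the gap x m - y n = d.
  gap-combine : ∀ {m n d} x y → d + y * n ≡ x * m → WeightGap A m → WeightGap A n → WeightGap A d
  gap-combine {m} {n} {d} x y eq P N = record
    { lower = x ·ᶠ lower P ∪ᶠ y ·ᶠ upper N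
    ; upper = x ·ᶠ upper P ∪ᶠ y ·ᶠ lower N
    ; lower-valid = ∪ᶠ-valid (·ᶠ-valid x (lower-valid P)) (·ᶠ-valid y (upper-valid N))
    ; upper-valid = ∪ᶠ-valid (·ᶠ-valid x (upper-valid P)) (·ᶠ-valid y (lower-valid N))
    ; weight-gap = begin
        weight (x ·ᶠ upper P ∪ᶠ y ·ᶠ lower N)   ≡⟨ weight-split (upper P) (lower N) ⟩
        x * weight (upper P) + y * weight (lower N)
          ≡⟨ cong (λ w → x * w + y * weight (lower N)) (weight-gap P) ⟩
        x * (weight (lower P) + m) + y * weight (lower N)
          ≡⟨ shuffle x y (weight (lower P)) (weight (lower N)) m ⟩
        x * weight (lower P) + y * weight (lower N) + x * m
          ≡⟨ cong (λ w → x * weight (lower P) + y * weight (lower N) + w) eq ⟨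
        x * weight (lower P) + y * weight (lower N) + (d + y * n)
          ≡⟨ shuffle′ x y (weight (lower P)) (weight (lower N)) n d ⟩
        x * weight (lower P) + y * (weight (lower N) + n) + d
          ≡⟨ cong (λ w → x * weight (lower P) + y * w + d) (weight-gap N) ⟨
        x * weight (lower P) + y * weight (upper N) + d
          ≡⟨ cong (_+ d) (weight-split (lower P) (upper N)) ⟨
        weight (x ·ᶠ lower P ∪ᶠ y ·ᶠ upper N) + d ∎ }
    where
    open ≡-Reasoning
    weight-split : ∀ F G → weight (x ·ᶠ F ∪ᶠ y ·ᶠ G) ≡ x * weight F + y * weight G
    weight-split F G = trans (weight-∪ (x ·ᶠ F) (y ·ᶠ G)) (cong₂ _+_ (weight-· x F) (weight-· y G))
    shuffle : ∀ x y a b m → x * (a + m) + y * b ≡ x * a + y * b + x * m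
    shuffle = ℕ-Solver.solve-∀
    shuffle′ : ∀ x y a b n d → x * a + y * b + (d + y * n) ≡ x * a + y * (b + n) + d
    shuffle′ = ℕ-Solver.solve-∀

  gap-gcd : ∀ {m n} → WeightGap A m → WeightGap A n → WeightGap A (gcd m n)
  gap-gcd {m} {n} P N with Bézout.identity (gcd-GCD m n)
  ... | Bézout.Identity.+- x y eq = gap-combine x y eq P N
  ... | Bézout.Identity.-+ x y eq = gap-combine y x eq N P

  gap-gcdList : (∀ i {x} → x ∈ A i → + 0 ℤ.≤ x) →
    ∀ xs → All (λ x → ∃ λ i → x ∈ A i) xs → WeightGap A ℤ.∣ gcdList xs ∣
  gap-gcdList nonneg []       []                  = gap-zero
  gap-gcdList nonneg (x ∷ xs) ((i , x∈A) ∷ xs∈A) = gap-gcd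
    (gap-element (subst (_∈ A i) (sym (ℤ.0≤i⇒+∣i∣≡i (nonneg i x∈A))) x∈A))
    (gap-gcdList nonneg xs xs∈A)

  gap-one : Normalized A → WeightGap A 1
  gap-one (isMin , gcd≡1) = subst (WeightGap A) (cong ℤ.∣_∣ gcd≡1) (gap-gcdList
    (λ i → All.lookup (proj₂ (proj₂ (isMin i))))
    (unionList A) (All.tabulate λ x∈ → satisfied (∈-concatMap⁻ A {xs = List.allFin q} x∈)))

-- Sorted 0/1-tuples

tuples-unique : ∀ {A} n → Unique A → Unique (tuples A n)
tuples-unique zero    A! = [] ∷ []
tuples-unique (suc n) A! = Unique.cartesianProductWith⁺ _∷_ ∷-injective A! (tuples-unique n A!)

chromTuples-unique : ∀ q {A : Fin q → FinSetℤ} h → (∀ i → Unique (A i)) → Unique (chromTuples q A h)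
chromTuples-unique zero    h A! = [] ∷ []
chromTuples-unique (suc q) h A! = Unique.cartesianProductWith⁺ _,_ (λ { refl → refl , refl })
  (Unique.filter⁺ sorted? (tuples-unique (h zero) (A! zero))) (chromTuples-unique q (h ∘ suc) (A! ∘ suc))

sorted-tail : ∀ {x n} {v : Vec ℤ n} → Sorted (x ∷ v) → Sorted v
sorted-tail {v = []}    _       = tt
sorted-tail {v = _ ∷ _} (_ , v↗) = v↗

Binary : FinSetℤ → Set
Binary A = ∀ {x} → x ∈ A → x ≡ + 0 ⊎ x ≡ + 1

binary-bounded : ∀ {A} → Binary A → Bounded A 1
binary-bounded binary x∈A with binary x∈A
... | inj₁ refl = ℤ.+≤+ z≤n , ℤ.+≤+ z≤n
... | inj₂ refl = ℤ.+≤+ z≤n , ℤ.+≤+ (s≤s z≤n)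

module _ {A} (binary : Binary A) where

  sorted-from-one : ∀ {n} {w : Vec ℤ n} → Vecᴬ.All (_∈ A) w → Sorted (+ 1 ∷ w) →
    + 1 ∷ w ≡ Vec.replicate (suc n) (+ 1)
  sorted-from-one Vecᴬ.[] _ = refl
  sorted-from-one (y∈A Vecᴬ.∷ w∈A) (1≤y , w↗) with binary y∈A
  ... | inj₁ refl = ⊥-elim (ℤ.<⇒≱ (ℤ.+<+ (s≤s z≤n)) 1≤y)
  ... | inj₂ refl = cong (+ 1 ∷_) (sorted-from-one w∈A w↗)

  vsum-ones : ∀ n → vsum (Vec.replicate n (+ 1)) ≡ + n
  vsum-ones zero    = refl
  vsum-ones (suc n) = cong (λ s → + 1 ℤ.+ s) (vsum-ones n)

  zero-headed≢one-headed : ∀ {n} {v w : Vec ℤ n} → Vecᴬ.All (_∈ A) v → Vecᴬ.All (_∈ A) w → Sorted (+ 1 ∷ w) →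
    vsum (+ 0 ∷ v) ≢ vsum (+ 1 ∷ w)
  zero-headed≢one-headed {n} {v} {w} v∈A w∈A 1∷w↗ eq = 1+n≰n (ℤ.drop‿+≤+ (begin
    + suc n                           ≡⟨ vsum-ones (suc n) ⟨
    vsum (Vec.replicate (suc n) (+ 1)) ≡⟨ cong vsum (sorted-from-one w∈A 1∷w↗) ⟨
    vsum (+ 1 ∷ w)                    ≡⟨ eq ⟨
    + 0 ℤ.+ vsum v                    ≡⟨ ℤ.+-identityˡ (vsum v) ⟩
    vsum v                            ≤⟨ proj₂ (vsum-bounds (binary-bounded binary) v∈A) ⟩
    + (n * 1)                         ≡⟨ cong +_ (*-identityʳ n) ⟩
    + n                               ∎))
    where open ℤ.≤-Reasoning

  sorted-binary-injective : ∀ {n} {v w : Vec ℤ n} → Vecᴬ.All (_∈ A) v → Vecᴬ.All (_∈ A) w →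
    Sorted v → Sorted w → vsum v ≡ vsum w → v ≡ w
  sorted-binary-injective Vecᴬ.[] Vecᴬ.[] _ _ _ = refl
  sorted-binary-injective {v = x ∷ v} {y ∷ w} (x∈A Vecᴬ.∷ v∈A) (y∈A Vecᴬ.∷ w∈A) x∷v↗ y∷w↗ eq
    with binary x∈A | binary y∈A
  ... | inj₁ refl | inj₁ refl = cong (+ 0 ∷_)
          (sorted-binary-injective v∈A w∈A (sorted-tail x∷v↗) (sorted-tail y∷w↗)
            (trans (sym (ℤ.+-identityˡ (vsum v))) (trans eq (ℤ.+-identityˡ (vsum w)))))
  ... | inj₂ refl | inj₂ refl = trans (sorted-from-one v∈A x∷v↗) (sym (sorted-from-one w∈A y∷w↗))
  ... | inj₁ refl | inj₂ refl = ⊥-elim (zero-headed≢one-headed {v = v} {w} v∈A w∈A y∷w↗ eq)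
  ... | inj₂ refl | inj₁ refl = ⊥-elim (zero-headed≢one-headed {v = w} {v} w∈A v∈A x∷v↗ (sym eq))

binary-rep≤1 : ∀ (A : Fin 1 → FinSetℤ) h n → Unique (A zero) → Binary (A zero) → rep A h n ≤ 1
binary-rep≤1 A h n A! binary =
  total-injective⇒rep≤1 A h n (chromTuples-unique 1 {A} h λ { zero → A! }) total-injective
  where
  S = sortedTuples (A zero) (h zero)
  total-injective : ∀ {c d} → c ∈ chromTuples 1 A h → d ∈ chromTuples 1 A h →
    total {h = h} c ≡ total {h = h} d → c ≡ d
  total-injective c∈ d∈ eq
    with ∈-cartesianProductWith⁻ _,_ S (tt ∷ []) c∈ | ∈-cartesianProductWith⁻ _,_ S (tt ∷ []) d∈
  ... | v , tt , v∈ , _ , refl | w , tt , w∈ , _ , refl =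
    let v∈A , v↗ = ∈-filter⁻ sorted? {xs = tuples (A zero) (h zero)} v∈
        w∈A , w↗ = ∈-filter⁻ sorted? {xs = tuples (A zero) (h zero)} w∈ in
    cong (_, tt) (sorted-binary-injective binary (∈-tuples⁻ v∈A) (∈-tuples⁻ w∈A) v↗ w↗
      (trans (sym (ℤ.+-identityʳ (vsum v))) (trans eq (ℤ.+-identityʳ (vsum w)))))

-- Colours are filled up to their budget smax in turn; the first one that does not fit takes
-- ⌊N / M⌋ copies and the later ones none.
greedy : ∀ {q} (M smax : Fin q → ℕ) {B N} → (∀ i → M i ≤ B) → N ≤ smax ∙ M →
  Σ (Fin q → ℕ) λ s → s ⪯ smax × s ∙ M ≤ N × N ≤ s ∙ M + B
greedy {zero}  M smax M≤B N≤0 = (λ ()) , (λ ()) , z≤n , ≤-trans N≤0 z≤n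
greedy {suc q} M smax {B} {N} M≤B N≤ with smax zero * M zero ≤? N
... | yes P≤N =
  let s , s⪯ , lo , hi = greedy (M ∘ suc) (smax ∘ suc) (M≤B ∘ suc) (m≤n+o⇒m∸n≤o N P N≤) in
  (smax zero Vector.∷ s) , (λ { zero → ≤-refl ; (suc i) → s⪯ i }) ,
  subst (P + s ∙ (M ∘ suc) ≤_) (m+[n∸m]≡n P≤N) (+-monoʳ-≤ P lo) ,
  subst (_≤ P + s ∙ (M ∘ suc) + B) (m+[n∸m]≡n P≤N)
    (subst (P + (N ∸ P) ≤_) (sym (+-assoc P (s ∙ (M ∘ suc)) B)) (+-monoʳ-≤ P hi))
  where P = smax zero * M zero
... | no P≰N = (N / M₀ Vector.∷ λ _ → 0) , (λ { zero → <⇒≤ (m<n*o⇒m/o<n N<P) ; (suc i) → z≤n }) , lo , hi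
  where
  M₀ = M zero
  N<P = ≰⇒> P≰N
  instance
    M₀≢0 : NonZero M₀
    M₀≢0 = ≢-nonZero λ M₀≡0 → n≮0 (subst (N <_) (trans (cong (smax zero *_) M₀≡0) (*-zeroʳ (smax zero))) N<P)
  no-rest : N / M₀ * M₀ + (λ _ → 0) ∙ (M ∘ suc) ≡ N / M₀ * M₀
  no-rest = trans (cong (λ w → N / M₀ * M₀ + w) (sum-replicate-zero q)) (+-identityʳ _)
  lo : N / M₀ * M₀ + (λ _ → 0) ∙ (M ∘ suc) ≤ N
  lo = subst (_≤ N) (sym no-rest) (m/n*n≤m N M₀)
  hi : N ≤ N / M₀ * M₀ + (λ _ → 0) ∙ (M ∘ suc) + B
  hi = begin
    N                   ≡⟨ m≡m%n+[m/n]*n N M₀ ⟩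
    N % M₀ + N / M₀ * M₀ ≡⟨ +-comm (N % M₀) _ ⟩
    N / M₀ * M₀ + N % M₀ ≤⟨ +-monoʳ-≤ (N / M₀ * M₀) (≤-trans (<⇒≤ (m%n<n N M₀)) (M≤B zero)) ⟩
    N / M₀ * M₀ + B      ≡⟨ cong (_+ B) no-rest ⟨
    N / M₀ * M₀ + (λ _ → 0) ∙ (M ∘ suc) + B ∎
    where open ≤-Reasoning

*-cancelʳ-≡-bounded : ∀ {t b i j} → t ≡ 0 ⊎ 1 ≤ b → i ≤ t → j ≤ t → i * b ≡ j * b → i ≡ j
*-cancelʳ-≡-bounded (inj₁ refl) i≤0 j≤0 _  = trans (n≤0⇒n≡0 i≤0) (sym (n≤0⇒n≡0 j≤0))
*-cancelʳ-≡-bounded {b = b} {i} {j} (inj₂ 1≤b) _ _ eq = *-cancelʳ-≡ i j b {{>-nonZero 1≤b}} eq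

block-decomposition : ∀ L .{{_ : NonZero L}} r k → k < suc r * L →
  ∃ λ (i : Fin (suc r)) → k ≡ toℕ i * L + k % L
block-decomposition L r k k< = Fin.fromℕ< k/L<1+r , (begin
  k                     ≡⟨ m≡m%n+[m/n]*n k L ⟩
  k % L + k / L * L     ≡⟨ +-comm (k % L) _ ⟩
  k / L * L + k % L     ≡⟨ cong (λ j → j * L + k % L) (toℕ-fromℕ< k/L<1+r) ⟨
  toℕ (Fin.fromℕ< k/L<1+r) * L + k % L ∎)
  where
  open ≡-Reasoning
  k/L<1+r = m<n*o⇒m/o<n k<

+[a+c]≡[a-b]+[b+c] : ∀ a b c → + (a + c) ≡ (+ a ℤ.- + b) ℤ.+ + (b + c)
+[a+c]≡[a-b]+[b+c] a b c = begin
  + (a + c)                       ≡⟨ ℤ.pos-+ a c ⟩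
  + a ℤ.+ + c                     ≡⟨ regroup (+ a) (+ b) (+ c) ⟩
  (+ a ℤ.- + b) ℤ.+ (+ b ℤ.+ + c) ≡⟨ cong (λ z → (+ a ℤ.- + b) ℤ.+ z) (ℤ.pos-+ b c) ⟨
  (+ a ℤ.- + b) ℤ.+ + (b + c)     ∎
  where
  open ≡-Reasoning
  regroup : ∀ x y z → x ℤ.+ z ≡ (x ℤ.- y) ℤ.+ (y ℤ.+ z)
  regroup = ℤ-Solver.solve-∀

-- The window inside a layer

LayerCovering : ∀ {q} → (Fin q → FinSetℤ) → ℕ → ℕ → Set
LayerCovering {q} A t r = Σ (Fin q → ℕ) λ h₀ → (h : Fin q → ℕ) → h₀ ⪯ h →
  Σ (List ℤ) λ X → length X ≤ r + 2 × (InLayer t A (scaleVec r h) ⊆ X ⊕ InLayer t A h)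

record Distinguisher {q} (A : Fin (suc q) → FinSetℤ) (D t′ : ℕ) : Set where
  field
    colour     : Fin (suc q)
    value      : ℕ
    value∈A    : + value ∈ A colour
    not-D      : colour ≡ zero → value ≢ D
    separating : t′ ≡ 0 ⊎ 1 ≤ value

module Window {q} {A : Fin (suc q) → FinSetℤ} (0∈A : ∀ i → + 0 ∈ A i)
  (M : Fin (suc q) → ℕ) (M∈A : ∀ i → + M i ∈ A i) (M₀-pos : 1 ≤ M zero) (gap : WeightGap A 1)
  (t′ : ℕ) (dist : Distinguisher A (M zero) t′) where

  D : ℕ
  D = M zero

  instance
    D≢0 : NonZero D
    D≢0 = >-nonZero M₀-pos

  open Distinguisher dist renaming (colour to c; value to b; value∈A to b∈A)
  open WeightGap gap

  -- reserve bounds, in every colour, the length of a candidate below apart from its bulk.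
  B ℓ base reserve : ℕ
  B = ∑[ i < suc q ] M i
  ℓ = ∑[ i < suc q ] (length (lower i) + length (upper i))
  base = pred D * weight lower + t′ * b * D
  reserve = pred D * ℓ + (t′ * D + (B + t′ * b))

  residue : ℕ → Family (suc q)
  residue ρ = ρ ·ᶠ upper ∪ᶠ (pred D ∸ ρ) ·ᶠ lower

  -- The j-th candidate trades t′ ∸ j blocks of D copies of b against j b copies of D, so
  -- candidates differ in the number of D's in colour zero.
  candidate : (Fin (suc q) → ℕ) → (ρ Q j : ℕ) → Family (suc q)
  candidate s ρ Q j =
    replicateᶠ s M ∪ᶠ residue ρ ∪ᶠ ((t′ ∸ j) * D) ·ᶠ atom c b ∪ᶠ (Q + j * b) ·ᶠ atom zero D

  residue-valid : ∀ ρ → ValidFamily A (residue ρ)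
  residue-valid ρ = ∪ᶠ-valid (·ᶠ-valid ρ upper-valid) (·ᶠ-valid (pred D ∸ ρ) lower-valid)

  candidate-valid : ∀ s ρ Q j → ValidFamily A (candidate s ρ Q j)
  candidate-valid s ρ Q j =
    ∪ᶠ-valid (replicateᶠ-valid s M∈A) (∪ᶠ-valid (residue-valid ρ)
      (∪ᶠ-valid (·ᶠ-valid ((t′ ∸ j) * D) (atom-valid b∈A)) (·ᶠ-valid (Q + j * b) (atom-valid (M∈A zero)))))

  residue-fits : ∀ {ρ} → ρ ≤ pred D → Fits (residue ρ) (λ _ → pred D * ℓ)
  residue-fits {ρ} ρ≤ = fits-weaken {F = residue ρ}
    (∪ᶠ-fits {F = ρ ·ᶠ upper} {G = (pred D ∸ ρ) ·ᶠ lower}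
      (·ᶠ-fits ρ {upper} (λ _ → ≤-refl)) (·ᶠ-fits (pred D ∸ ρ) {lower} (λ _ → ≤-refl)))
    λ i → begin
      ρ * length (upper i) + (pred D ∸ ρ) * length (lower i)
        ≤⟨ +-mono-≤ (*-monoˡ-≤ _ ρ≤) (*-monoˡ-≤ _ (m∸n≤m (pred D) ρ)) ⟩
      pred D * length (upper i) + pred D * length (lower i)
        ≡⟨ trans (*-distribˡ-+ (pred D) (length (lower i)) _) (+-comm (pred D * length (lower i)) _) ⟨
      pred D * (length (lower i) + length (upper i))
        ≤⟨ *-monoʳ-≤ (pred D) (≤-∑ (λ i → length (lower i) + length (upper i)) i) ⟩
      pred D * ℓ ∎
    where open ≤-Reasoning

  candidate-fits : ∀ s ρ Q j → ρ ≤ pred D → Q ≤ B → j ≤ t′ → Fits (candidate s ρ Q j) (λ i → s i + reserve)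
  candidate-fits s ρ Q j ρ≤ Q≤ j≤ = fits-weaken {F = candidate s ρ Q j}
    (∪ᶠ-fits {F = replicateᶠ s M} (replicateᶠ-fits s M)
      (∪ᶠ-fits {F = residue ρ} (residue-fits ρ≤)
        (∪ᶠ-fits {F = ((t′ ∸ j) * D) ·ᶠ atom c b} (·ᶠ-fits ((t′ ∸ j) * D) (atom-fits c b))
                                                 (·ᶠ-fits (Q + j * b) (atom-fits zero D)))))
    λ i → +-monoʳ-≤ (s i) (+-monoʳ-≤ (pred D * ℓ) (+-mono-≤ blocks≤ copies≤))
    where
    blocks≤ : (t′ ∸ j) * D * 1 ≤ t′ * D
    blocks≤ = ≤-trans (≤-reflexive (*-identityʳ _)) (*-monoˡ-≤ D (m∸n≤m t′ j))
    copies≤ : (Q + j * b) * 1 ≤ B + t′ * b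
    copies≤ = ≤-trans (≤-reflexive (*-identityʳ _)) (+-mono-≤ Q≤ (*-monoˡ-≤ b j≤))

  weight-residue : ∀ ρ → weight (residue ρ) ≡ ρ * (weight lower + 1) + (pred D ∸ ρ) * weight lower
  weight-residue ρ = trans (weight-∪ (ρ ·ᶠ upper) ((pred D ∸ ρ) ·ᶠ lower))
    (cong₂ _+_ (trans (weight-· ρ upper) (cong (ρ *_) weight-gap)) (weight-· (pred D ∸ ρ) lower))

  candidate-weight : ∀ s ρ Q j → ρ ≤ pred D → j ≤ t′ →
    weight (candidate s ρ Q j) ≡ s ∙ M + (base + (ρ + Q * D))
  candidate-weight s ρ Q j ρ≤ j≤ = begin
    weight (candidate s ρ Q j)
      ≡⟨ weight-∪ (replicateᶠ s M) (residue ρ ∪ᶠ T ∪ᶠ U) ⟩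
    weight (replicateᶠ s M) + weight (residue ρ ∪ᶠ T ∪ᶠ U)
      ≡⟨ cong (λ w → weight (replicateᶠ s M) + w) (weight-∪ (residue ρ) (T ∪ᶠ U)) ⟩
    weight (replicateᶠ s M) + (weight (residue ρ) + weight (T ∪ᶠ U))
      ≡⟨ cong₂ (λ x y → x + (weight (residue ρ) + y)) (weight-replicateᶠ s M) (weight-∪ T U) ⟩
    σ + (weight (residue ρ) + (weight T + weight U))
      ≡⟨ cong₂ (λ x y → σ + (x + y)) (weight-residue ρ)
               (cong₂ _+_ (weight-·atom ((t′ ∸ j) * D) c b) (weight-·atom (Q + j * b) zero D)) ⟩
    σ + (ρ * (s₀ + 1) + u * s₀ + ((t′ ∸ j) * D * b + (Q + j * b) * D))
      ≡⟨ cong (λ w → σ + w) (rearrange ρ u s₀ (t′ ∸ j) j b D Q) ⟩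
    σ + ((ρ + u) * s₀ + ((t′ ∸ j) + j) * b * D + (ρ + Q * D))
      ≡⟨ cong₂ (λ x y → σ + (x * s₀ + y * b * D + (ρ + Q * D))) (m+[n∸m]≡n ρ≤) (m∸n+n≡m j≤) ⟩
    σ + (base + (ρ + Q * D)) ∎
    where
    open ≡-Reasoning
    T = ((t′ ∸ j) * D) ·ᶠ atom c b
    U = (Q + j * b) ·ᶠ atom zero D
    σ = s ∙ M
    s₀ = weight lower
    u = pred D ∸ ρ
    rearrange : ∀ ρ u s₀ v j b D Q →
      ρ * (s₀ + 1) + u * s₀ + (v * D * b + (Q + j * b) * D) ≡ (ρ + u) * s₀ + (v + j) * b * D + (ρ + Q * D)
    rearrange = ℕ-Solver.solve-∀

  candidate-count : ∀ s ρ Q j → countₗ D (candidate s ρ Q j zero) ≡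
    countₗ D (replicateᶠ s M zero) + (countₗ D (residue ρ zero) + (Q + j * b))
  candidate-count s ρ Q j = begin
    countₗ D (candidate s ρ Q j zero)
      ≡⟨ countₗ-++ D (replicateᶠ s M zero) _ ⟩
    countₗ D (replicateᶠ s M zero) + countₗ D (residue ρ zero ++ T zero ++ U zero)
      ≡⟨ cong (λ w → countₗ D (replicateᶠ s M zero) + w) (countₗ-++ D (residue ρ zero) _) ⟩
    countₗ D (replicateᶠ s M zero) + (countₗ D (residue ρ zero) + countₗ D (T zero ++ U zero))
      ≡⟨ cong (λ n → countₗ D (replicateᶠ s M zero) + (countₗ D (residue ρ zero) + n))
              (trans (countₗ-++ D (T zero) (U zero))
                     (cong₂ _+_ (countₗ-atom-other c not-D ((t′ ∸ j) * D))
                                (countₗ-atom-zero D (Q + j * b)))) ⟩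
    countₗ D (replicateᶠ s M zero) + (countₗ D (residue ρ zero) + (Q + j * b)) ∎
    where
    open ≡-Reasoning
    T = ((t′ ∸ j) * D) ·ᶠ atom c b
    U = (Q + j * b) ·ᶠ atom zero D

  candidates-injective : ∀ {h} s ρ Q {j j′} → j ≤ t′ → j′ ≤ t′ →
    Fits (candidate s ρ Q j) h → Fits (candidate s ρ Q j′) h →
    build {h = h} (candidate s ρ Q j) ≡ build {h = h} (candidate s ρ Q j′) → j ≡ j′
  candidates-injective s ρ Q {j} {j′} j≤ j′≤ fits fits′ same =
    *-cancelʳ-≡-bounded separating j≤ j′≤ (+-cancelˡ-≡ Q _ _ (+-cancelˡ-≡ C₂ _ _ (+-cancelˡ-≡ C₁ _ _ (begin
      C₁ + (C₂ + (Q + j * b))               ≡⟨ candidate-count s ρ Q j ⟨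
      countₗ D (candidate s ρ Q j zero)
        ≡⟨ count-build (≢-nonZero⁻¹ D) (candidate s ρ Q j) (candidate s ρ Q j′) fits fits′ same ⟩
      countₗ D (candidate s ρ Q j′ zero)    ≡⟨ candidate-count s ρ Q j′ ⟩
      C₁ + (C₂ + (Q + j′ * b))              ∎))))
    where
    open ≡-Reasoning
    C₁ = countₗ D (replicateᶠ s M zero)
    C₂ = countₗ D (residue ρ zero)

  record Split (h : Fin (suc q) → ℕ) (m : ℕ) : Set where
    field
      bulk   : Fin (suc q) → ℕ
      ρ Q    : ℕ
      bulk⪯  : bulk ⪯ (λ i → h i ∸ reserve)
      ρ≤     : ρ ≤ pred D
      Q≤B    : Q ≤ B
      split≡ : bulk ∙ M + (base + (ρ + Q * D)) ≡ m

  split : ∀ h m → base ≤ m → m ≤ base + (λ i → h i ∸ reserve) ∙ M → Split h m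
  split h m base≤m m≤ = record
    { bulk = s ; ρ = rem % D ; Q = rem / D ; bulk⪯ = s⪯
    ; ρ≤ = <⇒≤pred (m%n<n rem D)
    ; Q≤B = ≤-trans (m/n≤m rem D) (m≤n+o⇒m∸n≤o N (s ∙ M) N≤)
    ; split≡ = begin
        s ∙ M + (base + (rem % D + rem / D * D)) ≡⟨ cong (λ r → s ∙ M + (base + r)) (m≡m%n+[m/n]*n rem D) ⟨
        s ∙ M + (base + rem)                     ≡⟨ cong (λ w → s ∙ M + w) (+-comm base rem) ⟩
        s ∙ M + (rem + base)                     ≡⟨ +-assoc (s ∙ M) rem base ⟨
        s ∙ M + rem + base                       ≡⟨ cong (_+ base) (m+[n∸m]≡n σ≤N) ⟩
        N + base                                 ≡⟨ m∸n+n≡m base≤m ⟩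
        m                                        ∎ }
    where
    open ≡-Reasoning
    N = m ∸ base
    greedy-split = greedy M (λ i → h i ∸ reserve) (≤-∑ M) (m≤n+o⇒m∸n≤o m base m≤)
    s = proj₁ greedy-split
    s⪯ = proj₁ (proj₂ greedy-split)
    σ≤N = proj₁ (proj₂ (proj₂ greedy-split))
    N≤ = proj₂ (proj₂ (proj₂ greedy-split))
    rem = N ∸ s ∙ M

  window⊆layer : ∀ h → (∀ i → reserve ≤ h i) → ∀ m → base ≤ m →
    m ≤ base + (λ i → h i ∸ reserve) ∙ M → suc t′ ≤ rep A h (+ m)
  window⊆layer h reserve≤h m base≤m m≤ = families⇒≤rep F 0∈A
    (λ j → candidate-valid bulk ρ Q (toℕ j)) F-fits
    (λ j → trans (candidate-weight bulk ρ Q (toℕ j) ρ≤ (toℕ≤pred[n] j)) split≡)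
    (λ {j} {j′} → toℕ-injective ∘
      candidates-injective bulk ρ Q (toℕ≤pred[n] j) (toℕ≤pred[n] j′) (F-fits j) (F-fits j′))
    where
    open Split (split h m base≤m m≤)
    F : Fin (suc t′) → Family (suc q)
    F j = candidate bulk ρ Q (toℕ j)
    F-fits : ∀ j → Fits (F j) h
    F-fits j = fits-weaken {F = F j} (candidate-fits bulk ρ Q (toℕ j) ρ≤ Q≤B (toℕ≤pred[n] j))
      λ i → ≤-trans (+-monoˡ-≤ reserve (bulk⪯ i)) (≤-reflexive (m∸n+n≡m (reserve≤h i)))

  -- Large enough that r reserve B ≤ W, so that r + 1 windows of length W + 1 cover [0, r H].
  threshold : ℕ → Fin (suc q) → ℕ
  threshold r _ = reserve + r * (reserve * B)

  translates : ℕ → ℕ → List ℤ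
  translates L r = map (λ i → + (toℕ i * L) ℤ.- + base) (List.allFin (suc r))

  length-translates : ∀ L r → length (translates L r) ≤ r + 2
  length-translates L r = begin
    length (translates L r)  ≡⟨ length-map _ (List.allFin (suc r)) ⟩
    length (List.allFin (suc r)) ≡⟨ length-tabulate (λ i → i) ⟩
    suc r                    ≡⟨ +-comm 1 r ⟩
    r + 1                    ≤⟨ +-monoʳ-≤ r (n≤1+n 1) ⟩
    r + 2 ∎
    where open ≤-Reasoning

  scaled-layer-covered : (∀ i → Bounded (A i) (M i)) → ∀ r h → threshold r ⪯ h →
    let W = (λ i → h i ∸ reserve) ∙ M in
    InLayer (suc t′) A (scaleVec r h) ⊆ translates (suc W) r ⊕ InLayer (suc t′) A h
  scaled-layer-covered bounded r h threshold⪯h n n∈layer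
    with 1≤rep⇒bounded M bounded (scaleVec r h) n (≤-trans (s≤s z≤n) n∈layer)
  ... | k , refl , k≤ =
    let i , k≡ = block-decomposition L r k k<
    in + (toℕ i * L) ℤ.- + base , + (base + k % L) , ∈-map⁺ _ (∈-allFin i) ,
       window⊆layer h reserve≤h (base + k % L) (m≤m+n base _) (+-monoʳ-≤ base (ℕ.s≤s⁻¹ (m%n<n k L))) ,
       trans (cong +_ k≡) (+[a+c]≡[a-b]+[b+c] (toℕ i * L) base (k % L))
    where
    W = (λ i → h i ∸ reserve) ∙ M
    L = suc W
    reserve≤h : ∀ i → reserve ≤ h i
    reserve≤h i = ≤-trans (m≤m+n reserve _) (threshold⪯h i)
    slack : r * (reserve * B) ≤ W
    slack = begin
      r * (reserve * B)
        ≤⟨ m+n≤o⇒m≤o∸n (r * (reserve * B)) (subst (_≤ h zero) (+-comm reserve _) (threshold⪯h zero)) ⟩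
      h zero ∸ reserve         ≤⟨ m≤m*n (h zero ∸ reserve) D ⟩
      (h zero ∸ reserve) * D   ≤⟨ ≤-∑ (λ i → (h i ∸ reserve) * M i) zero ⟩
      W                        ∎
      where open ≤-Reasoning
    k< : k < suc r * L
    k< = begin-strict
      k                                                ≤⟨ k≤ ⟩
      scaleVec r h ∙ M                                 ≡⟨ scaleVec-∙ r h M ⟩
      r * (h ∙ M)                                      ≡⟨ cong (r *_) (∙-reserve reserve h M reserve≤h) ⟩
      r * (W + reserve * B)                            ≡⟨ *-distribˡ-+ r W _ ⟩
      r * W + r * (reserve * B)                        ≤⟨ +-monoʳ-≤ (r * W) slack ⟩
      r * W + W                                        ≡⟨ +-comm (r * W) W ⟩
      W + r * W                                        <⟨ s≤s (+-monoʳ-≤ W (*-monoʳ-≤ r (n≤1+n W))) ⟩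
      suc r * L                                        ∎
      where open ≤-Reasoning

  layerCovering : (∀ i → Bounded (A i) (M i)) → ∀ r → LayerCovering A (suc t′) r
  layerCovering bounded r = threshold r , λ h threshold⪯h →
    translates _ r , length-translates _ r , scaled-layer-covered bounded r h threshold⪯h

∣-gcdList : ∀ {d} xs → All (λ x → d ∣ ℤ.∣ x ∣) xs → d ∣ ℤ.∣ gcdList xs ∣
∣-gcdList {d} []       []            = d ∣0
∣-gcdList     (x ∷ xs) (d∣x ∷ d∣xs) = gcd-greatest d∣x (∣-gcdList xs d∣xs)

record Maxima {q} (A : Fin q → FinSetℤ) : Set where
  field
    M       : Fin q → ℕ
    M∈A     : ∀ i → + M i ∈ A i
    M-pos   : ∀ i → 1 ≤ M i
    bounded : ∀ i → Bounded (A i) (M i)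

module _ {q} {A : Fin q → FinSetℤ} (norm : Normalized A) where

  0∈A : ∀ i → + 0 ∈ A i
  0∈A i = proj₁ (proj₂ (proj₁ norm i))

  maxima : ((i : Fin q) → Σ ℤ λ a → IsMax a (A i) × + 1 ℤ.≤ a) → Maxima A
  maxima mx = record
    { M = M ; M∈A = λ i → subst (_∈ A i) (a≡M i) (proj₁ (IsMax-a i))
    ; M-pos = λ i → ℤ.drop‿+≤+ (subst (+ 1 ℤ.≤_) (a≡M i) (proj₂ (proj₂ (mx i))))
    ; bounded = λ i x∈A → All.lookup (proj₂ (proj₂ (proj₁ norm i))) x∈A
                         , subst (λ a → _ ℤ.≤ a) (a≡M i) (All.lookup (proj₂ (IsMax-a i)) x∈A) }
    where
    IsMax-a : ∀ i → IsMax (proj₁ (mx i)) (A i)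
    IsMax-a i = proj₁ (proj₂ (mx i))
    M : Fin q → ℕ
    M i = ℤ.∣ proj₁ (mx i) ∣
    a≡M : ∀ i → proj₁ (mx i) ≡ + M i
    a≡M i = sym (ℤ.0≤i⇒+∣i∣≡i (ℤ.≤-trans (ℤ.+≤+ z≤n) (proj₂ (proj₂ (mx i)))))

normalized⇒layerCovering : ∀ {q} {A : Fin (suc q) → FinSetℤ} → Normalized A → (max : Maxima A) →
  ∀ {t′} → Distinguisher A (Maxima.M max zero) t′ → ∀ r → LayerCovering A (suc t′) r
normalized⇒layerCovering norm max dist =
  Window.layerCovering (0∈A norm) M M∈A (M-pos zero) (gap-one norm) _ dist bounded
  where open Maxima max

trivial-distinguisher : ∀ {q} {A : Fin (suc q) → FinSetℤ} (max : Maxima A) →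
  (∀ i → + 0 ∈ A i) → Distinguisher A (Maxima.M max zero) 0
trivial-distinguisher max 0∈A = record
  { colour = zero ; value = 0 ; value∈A = 0∈A zero
  ; not-D = λ _ 0≡M → contradiction (subst (1 ≤_) (sym 0≡M) (M-pos zero)) λ ()
  ; separating = inj₁ refl }
  where open Maxima max

second-colour-distinguisher : ∀ {q} {A : Fin (suc (suc q)) → FinSetℤ} (max : Maxima A) →
  ∀ t′ → Distinguisher A (Maxima.M max zero) t′
second-colour-distinguisher max t′ = record
  { colour = suc zero ; value = M (suc zero) ; value∈A = M∈A (suc zero)
  ; not-D = λ () ; separating = inj₂ (M-pos (suc zero)) }
  where open Maxima max

module _ {A : Fin 1 → FinSetℤ} (max : Maxima A) where
  open Maxima max

  ZeroOrTop : ℤ → Set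
  ZeroOrTop x = x ≡ + 0 ⊎ x ≡ + M zero

  zeroOrTop? : ∀ x → Dec (ZeroOrTop x)
  zeroOrTop? x = x ℤ.≟ + 0 ⊎-dec x ℤ.≟ + M zero

  distinguisher-or-zeroOrTop : ∀ t′ → Distinguisher A (M zero) t′ ⊎ All ZeroOrTop (A zero)
  distinguisher-or-zeroOrTop t′ with All.all? zeroOrTop? (A zero)
  ... | yes zero-or-top = inj₂ zero-or-top
  ... | no ¬zero-or-top with find (¬All⇒Any¬ zeroOrTop? (A zero) ¬zero-or-top)
  ...   | x , x∈A , x∉ = inj₁ record
    { colour = zero ; value = ℤ.∣ x ∣ ; value∈A = subst (_∈ A zero) x≡∣x∣ x∈A
    ; not-D = λ _ ∣x∣≡M → x∉ (inj₂ (trans x≡∣x∣ (cong +_ ∣x∣≡M)))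
    ; separating = inj₂ (n≢0⇒n>0 λ ∣x∣≡0 → x∉ (inj₁ (trans x≡∣x∣ (cong +_ ∣x∣≡0)))) }
    where
    x≡∣x∣ : x ≡ + ℤ.∣ x ∣
    x≡∣x∣ = sym (ℤ.0≤i⇒+∣i∣≡i (proj₁ (bounded zero x∈A)))

  top≡1 : Normalized A → All ZeroOrTop (A zero) → M zero ≡ 1
  top≡1 (_ , gcd≡1) zero-or-top = ∣1⇒≡1 (subst (M zero ∣_) (cong ℤ.∣_∣ gcd≡1)
    (∣-gcdList (A zero ++ []) (All.++⁺ (All.map top-divides zero-or-top) [])))
    where
    top-divides : ∀ {x} → ZeroOrTop x → M zero ∣ ℤ.∣ x ∣
    top-divides (inj₁ refl) = M zero ∣0
    top-divides (inj₂ refl) = ∣-refl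

  zero-or-top⇒binary : Normalized A → All ZeroOrTop (A zero) → Binary (A zero)
  zero-or-top⇒binary norm zero-or-top {x} x∈A =
    subst (λ m → x ≡ + 0 ⊎ x ≡ + m) (top≡1 norm zero-or-top) (All.lookup zero-or-top x∈A)

theorem1p17 : (q : ℕ) (A : Fin q → FinSetℤ) → Normalized A →
    ((i : Fin q) → Σ ℤ λ a → IsMax a (A i) × + 1 ℤ.≤ a) →
    (t r : ℕ) → 1 ≤ t → 1 ≤ r →
    Σ (Fin q → ℕ) λ h₀ → (h : Fin q → ℕ) → h₀ ⪯ h →
      Σ (List ℤ) λ X → length X ≤ r + 2 ×
        (InLayer t A (scaleVec r h) ⊆ X ⊕ InLayer t A h)
theorem1p17 zero          A (_ , ()) _  _                _ _  _ -- the gcd of no sets is 0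
theorem1p17 (suc q)       A norm     mx zero             r () _
theorem1p17 (suc q)       A norm     mx (suc zero)       r _ _ =
  normalized⇒layerCovering norm (maxima norm mx) (trivial-distinguisher (maxima norm mx) (0∈A norm)) r
theorem1p17 (suc (suc q)) A norm     mx (suc (suc t′))   r _ _ =
  normalized⇒layerCovering norm (maxima norm mx) (second-colour-distinguisher (maxima norm mx) (suc t′)) r
theorem1p17 (suc zero)    A norm     mx (suc (suc t′))   r _ _
  with distinguisher-or-zeroOrTop (maxima norm mx) (suc t′)
... | inj₁ dist        = normalized⇒layerCovering norm (maxima norm mx) dist r
... | inj₂ zero-or-top = (λ _ → 0) , λ h _ → [] , z≤n , λ n n∈layer → contradiction
  (≤-trans n∈layer (binary-rep≤1 A (scaleVec r h) n (proj₁ (proj₁ norm zero))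
    (zero-or-top⇒binary (maxima norm mx) norm zero-or-top)))
  λ { (s≤s ()) }
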